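{- Let $\mathbf{B}$ be a finite relational structure, let $F$ be an encoding for $\mathbf{B}$ with underlying finite set $D$, and let $\sigma=(\rho,\tau)$ be an inner symmetry of $\mathbf{B}$ and $F$. Let $V$ be a non-empty finite set. For any map $u: A_{V,F}\to B$, define $u': A_{V,F}\to B$ by $u'(\alpha)=u(\widetilde{\sigma}(\alpha))$. Then $u\in\langle T_V\rangle_{\mathbf{B}}$ if and only if $u'\in\langle T_V\rangle_{\mathbf{B}}$.
   Context: Structures have a finite signature and finite universe. A $\wedge$-formula is a conjunction of atoms $R(v_1,\dots,v_k)$ and variable equalities with the usual satisfaction over $\mathbf{B}$. For a finite set $S$, a set of maps $S\to B$ is $\wedge$-definable if it is the set of satisfying assignments $S\to B$ of a $\wedge$-formula with variables from $S$; $\langle T\rangle_{\mathbf{B}}$ is the smallest $\wedge$-definable set of maps containing $T$. An automorphism of $\mathbf{B}$ is a bijection of $B$ preserving each relation in both directions. An encoding: finite set $D$ and finite set $F$ of maps $f: D^k\to B$, $k\ge 0$ the arity ($D^0$ contains only the empty tuple). For a finite set $V$: $G_{V,D}$ = all maps $V\to D$; a $(V,F)$-application is a pair $(\bar v,f)$, $f\in F$, $\bar v$ a tuple over $V$ of length the arity of $f$; $A_{V,F}$ the set of them; for $g\in G_{V,D}$, $\alpha=((v_1,\dots,v_k),f)$, $\alpha[g]=f(g(v_1),\dots,g(v_k))$; $t[g]:\alpha\mapsto\alpha[g]$; $T_V=\{t[g]\mid g\in G_{V,D}\}$. An inner symmetry (relative to $\mathbf{B}$ and $F$) is a pair $\sigma=(\rho,\tau)$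 where $\rho: D\to D$ is a bijection and $\tau: B\to B$ is an automorphism of $\mathbf{B}$, such that $F=\{\widetilde{\sigma}(f)\mid f\in F\}$, where for $g: D^k\to B$, $\widetilde{\sigma}(g)=\tau\circ g\circ(\rho,\dots,\rho)$ with $(\rho,\dots,\rho)$ applying $\rho$ to each coordinate. For an application $\alpha=(\bar v,f)$, $\widetilde{\sigma}(\alpha)=(\bar v,\widetilde{\sigma}(f))$. -}

module Defs where

open import Level using (0ℓ)
open import Data.Nat using (ℕ)
open import Data.Fin using (Fin)
open import Data.Vec using (Vec; map)
open import Data.List using (List)
open import Data.List.Relation.Unary.All using (All)
open import Data.Product using (Σ; ∃; _×_; _,_)
open import Relation.Unary using (Pred)
open import Relation.Binary.PropositionalEquality using (_≡_; subst)
open import Function.Definitions using (Bijective)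

record Structure : Set₁ where
  field
    size   : ℕ
    nSym   : ℕ
    arity  : Fin nSym → ℕ
    rel    : (r : Fin nSym) → Pred (Vec (Fin size) (arity r)) 0ℓ

open Structure public

record IsAutomorphism (𝔅 : Structure) (τ : Fin (size 𝔅) → Fin (size 𝔅)) : Set where
  field
    bijective : Bijective _≡_ _≡_ τ
    preserves : ∀ r (xs : Vec (Fin (size 𝔅)) (arity 𝔅 r)) →
                rel 𝔅 r xs → rel 𝔅 r (map τ xs)
    reflects  : ∀ r (xs : Vec (Fin (size 𝔅)) (arity 𝔅 r)) →
                rel 𝔅 r (map τ xs) → rel 𝔅 r xs

data Atom (𝔅 : Structure) (X : Set) : Set where
  atom : (r : Fin (nSym 𝔅)) → Vec X (arity 𝔅 r) → Atom 𝔅 X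
  eq   : X → X → Atom 𝔅 X

Formula : Structure → Set → Set
Formula 𝔅 X = List (Atom 𝔅 X)

SatAtom : (𝔅 : Structure) {X : Set} → (X → Fin (size 𝔅)) → Atom 𝔅 X → Set
SatAtom 𝔅 s (atom r xs) = rel 𝔅 r (map s xs)
SatAtom 𝔅 s (eq x y)    = s x ≡ s y

Sat : (𝔅 : Structure) {X : Set} → (X → Fin (size 𝔅)) → Formula 𝔅 X → Set
Sat 𝔅 s φ = All (SatAtom 𝔅 s) φ

-- Membership in ⟨ T ⟩_𝔅: the smallest ∧-definable set of maps X → B
-- containing T, i.e. the intersection of all ∧-definable sets ⊇ T.
InClosure : (𝔅 : Structure) {X : Set} → Pred (X → Fin (size 𝔅)) 0ℓ →
            (X → Fin (size 𝔅)) → Set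
InClosure 𝔅 {X} T u =
  (φ : Formula 𝔅 X) → (∀ t → T t → Sat 𝔅 t φ) → Sat 𝔅 u φ

SameMap : (d b : ℕ) (k : ℕ) → (Vec (Fin d) k → Fin b) →
          (l : ℕ) → (Vec (Fin d) l → Fin b) → Set
SameMap d b k f l g =
  Σ (k ≡ l) λ p → ∀ (x : Vec (Fin d) k) → f x ≡ g (subst (Vec (Fin d)) p x)

-- An encoding for 𝔅: a finite set D = Fin dom and a finite set F of maps
-- D^k → B, given as a duplicate-free family indexed by Fin nF.
record Encoding (𝔅 : Structure) : Set where
  field
    dom     : ℕ
    nF      : ℕ
    ar      : Fin nF → ℕ
    fun     : (i : Fin nF) → Vec (Fin dom) (ar i) → Fin (size 𝔅)
    distinct : ∀ i j → SameMap dom (size 𝔅) (ar i) (fun i) (ar j) (fun j) → i ≡ j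

open Encoding public

σ̃ : (𝔅 : Structure) (E : Encoding 𝔅) →
    (Fin (dom E) → Fin (dom E)) → (Fin (size 𝔅) → Fin (size 𝔅)) →
    ∀ {k} → (Vec (Fin (dom E)) k → Fin (size 𝔅)) → Vec (Fin (dom E)) k → Fin (size 𝔅)
σ̃ 𝔅 E ρ τ g xs = τ (g (map ρ xs))

record IsInnerSymmetry (𝔅 : Structure) (E : Encoding 𝔅)
         (ρ : Fin (dom E) → Fin (dom E)) (τ : Fin (size 𝔅) → Fin (size 𝔅)) : Set where
  field
    ρ-bijective : Bijective _≡_ _≡_ ρ
    τ-auto      : IsAutomorphism 𝔅 τ
    image⊆F     : ∀ i → ∃ λ j →
                  SameMap (dom E) (size 𝔅) (ar E i) (σ̃ 𝔅 E ρ τ (fun E i)) (ar E j) (fun E j)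
    F⊆image     : ∀ j → ∃ λ i →
                  SameMap (dom E) (size 𝔅) (ar E i) (σ̃ 𝔅 E ρ τ (fun E i)) (ar E j) (fun E j)

-- A (V,F)-application (v̄, f) with f = fun i, v̄ a tuple over V of length ar i.
App : (𝔅 : Structure) → Encoding 𝔅 → ℕ → Set
App 𝔅 E nV = Σ (Fin (nF E)) λ i → Vec (Fin nV) (ar E i)

apply : (𝔅 : Structure) (E : Encoding 𝔅) {nV : ℕ} →
        App 𝔅 E nV → (Fin nV → Fin (dom E)) → Fin (size 𝔅)
apply 𝔅 E (i , vs) g = fun E i (map g vs)

-- T_V = { t[g] | g ∈ G_{V,D} }  (t given as a map A_{V,F} → B)
T : (𝔅 : Structure) (E : Encoding 𝔅) (nV : ℕ) → Pred (App 𝔅 E nV → Fin (size 𝔅)) 0ℓ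
T 𝔅 E nV t = ∃ λ (g : Fin nV → Fin (dom E)) → ∀ α → t α ≡ apply 𝔅 E α g

IsSigmaImage : (𝔅 : Structure) (E : Encoding 𝔅) {nV : ℕ} →
               (Fin (dom E) → Fin (dom E)) → (Fin (size 𝔅) → Fin (size 𝔅)) →
               App 𝔅 E nV → App 𝔅 E nV → Set
IsSigmaImage 𝔅 E {nV} ρ τ (i , vs) (j , ws) =
  Σ (ar E i ≡ ar E j) λ p →
    (∀ (x : Vec (Fin (dom E)) (ar E i)) →
       σ̃ 𝔅 E ρ τ (fun E i) x ≡ fun E j (subst (Vec (Fin (dom E))) p x))
    × subst (Vec (Fin nV)) p vs ≡ ws

module Submission where

open import Defs
open import Data.Nat using (ℕ; _≤_)
open import Data.Fin using (Fin)
open import Data.Vec using (Vec; map)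
open import Data.Vec.Properties using (map-cong; map-∘)
open import Data.List using ([]; _∷_)
open import Data.List.Relation.Unary.All using ([]; _∷_)
open import Data.Product using (∃; _,_; proj₁; proj₂)
open import Function using (_∘_)
open import Function.Bundles using (_⇔_; mk⇔)
open import Relation.Binary.PropositionalEquality
  using (_≡_; _≗_; refl; sym; trans; cong; subst; module ≡-Reasoning)
open import Relation.Binary.PropositionalEquality.Properties
  using (subst-application′; subst-subst-sym)
open import Relation.Unary using (Pred)
open import Level using (0ℓ)

-- Composing with the permutation α ↦ σ̃(α) of A_{V,F} maps each
-- generator t[g] to τ ∘ t[ρ ∘ g], and conversely τ ∘ (t[g] ∘ σ̃⁻¹) = t[ρ⁻¹ ∘ g].
-- Renaming the variables of a ∧-formula along a map, and applying an
-- automorphism, both preserve satisfaction, so ⟨T_V⟩ is stable under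
-- precomposition with σ̃ and with σ̃⁻¹.

module _ (𝔅 : Structure) where

  renameAtom : {X Y : Set} → (X → Y) → Atom 𝔅 X → Atom 𝔅 Y
  renameAtom s (atom r xs) = atom r (map s xs)
  renameAtom s (eq x y)    = eq (s x) (s y)

  rename : {X Y : Set} → (X → Y) → Formula 𝔅 X → Formula 𝔅 Y
  rename s []      = []
  rename s (a ∷ φ) = renameAtom s a ∷ rename s φ

  Sat-rename⁻ : {X Y : Set} (s : X → Y) (w : Y → Fin (size 𝔅)) (φ : Formula 𝔅 X) →
                Sat 𝔅 w (rename s φ) → Sat 𝔅 (w ∘ s) φ
  Sat-rename⁻ s w []              []       = []
  Sat-rename⁻ s w (atom r xs ∷ φ) (h ∷ hs) =
    subst (rel 𝔅 r) (sym (map-∘ w s xs)) h ∷ Sat-rename⁻ s w φ hs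
  Sat-rename⁻ s w (eq x y ∷ φ)    (h ∷ hs) = h ∷ Sat-rename⁻ s w φ hs

  Sat-rename⁺ : {X Y : Set} (s : X → Y) (w : Y → Fin (size 𝔅)) (φ : Formula 𝔅 X) →
                Sat 𝔅 (w ∘ s) φ → Sat 𝔅 w (rename s φ)
  Sat-rename⁺ s w []              []       = []
  Sat-rename⁺ s w (atom r xs ∷ φ) (h ∷ hs) =
    subst (rel 𝔅 r) (map-∘ w s xs) h ∷ Sat-rename⁺ s w φ hs
  Sat-rename⁺ s w (eq x y ∷ φ)    (h ∷ hs) = h ∷ Sat-rename⁺ s w φ hs

  Sat-cong : {X : Set} {w w' : X → Fin (size 𝔅)} → w ≗ w' →
             (φ : Formula 𝔅 X) → Sat 𝔅 w φ → Sat 𝔅 w' φ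
  Sat-cong w≗w' []              []       = []
  Sat-cong w≗w' (atom r xs ∷ φ) (h ∷ hs) =
    subst (rel 𝔅 r) (map-cong w≗w' xs) h ∷ Sat-cong w≗w' φ hs
  Sat-cong w≗w' (eq x y ∷ φ)    (h ∷ hs) =
    trans (sym (w≗w' x)) (trans h (w≗w' y)) ∷ Sat-cong w≗w' φ hs

  module _ {τ : Fin (size 𝔅) → Fin (size 𝔅)} (τ-auto : IsAutomorphism 𝔅 τ) where
    open IsAutomorphism τ-auto

    Sat-automorphism⁺ : {X : Set} (w : X → Fin (size 𝔅)) (φ : Formula 𝔅 X) →
                        Sat 𝔅 w φ → Sat 𝔅 (τ ∘ w) φ
    Sat-automorphism⁺ w []              []       = []
    Sat-automorphism⁺ w (atom r xs ∷ φ) (h ∷ hs) =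
      subst (rel 𝔅 r) (sym (map-∘ τ w xs)) (preserves r _ h) ∷ Sat-automorphism⁺ w φ hs
    Sat-automorphism⁺ w (eq x y ∷ φ)    (h ∷ hs) = cong τ h ∷ Sat-automorphism⁺ w φ hs

    Sat-automorphism⁻ : {X : Set} (w : X → Fin (size 𝔅)) (φ : Formula 𝔅 X) →
                        Sat 𝔅 (τ ∘ w) φ → Sat 𝔅 w φ
    Sat-automorphism⁻ w []              []       = []
    Sat-automorphism⁻ w (atom r xs ∷ φ) (h ∷ hs) =
      reflects r _ (subst (rel 𝔅 r) (map-∘ τ w xs) h) ∷ Sat-automorphism⁻ w φ hs
    Sat-automorphism⁻ w (eq x y ∷ φ)    (h ∷ hs) =
      proj₁ bijective h ∷ Sat-automorphism⁻ w φ hs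

    InClosure-automorphism⁺ : {X : Set} {S : Pred (X → Fin (size 𝔅)) 0ℓ} {w : X → Fin (size 𝔅)} →
                              S w → InClosure 𝔅 S (τ ∘ w)
    InClosure-automorphism⁺ w∈S φ S⊨φ = Sat-automorphism⁺ _ φ (S⊨φ _ w∈S)

    InClosure-automorphism⁻ : {X : Set} {S : Pred (X → Fin (size 𝔅)) 0ℓ} {w : X → Fin (size 𝔅)} →
                              S (τ ∘ w) → InClosure 𝔅 S w
    InClosure-automorphism⁻ τw∈S φ S⊨φ = Sat-automorphism⁻ _ φ (S⊨φ _ τw∈S)

  InClosure-cong : {X : Set} {S : Pred (X → Fin (size 𝔅)) 0ℓ} {w w' : X → Fin (size 𝔅)} →
                   w ≗ w' → InClosure 𝔅 S w → InClosure 𝔅 S w'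
  InClosure-cong w≗w' w∈⟨S⟩ φ S⊨φ = Sat-cong w≗w' φ (w∈⟨S⟩ φ S⊨φ)

  InClosure-∘ : {X Y : Set} {S : Pred (Y → Fin (size 𝔅)) 0ℓ} {S' : Pred (X → Fin (size 𝔅)) 0ℓ}
                (s : X → Y) → (∀ t → S t → InClosure 𝔅 S' (t ∘ s)) →
                {w : Y → Fin (size 𝔅)} → InClosure 𝔅 S w → InClosure 𝔅 S' (w ∘ s)
  InClosure-∘ s S∘s⊆⟨S'⟩ {w} w∈⟨S⟩ φ S'⊨φ =
    Sat-rename⁻ s w φ (w∈⟨S⟩ (rename s φ) λ t t∈S →
      Sat-rename⁺ s t φ (S∘s⊆⟨S'⟩ t t∈S φ S'⊨φ))

module _ {𝔅 : Structure} {E : Encoding 𝔅} {nV : ℕ}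
         {ρ : Fin (dom E) → Fin (dom E)} {τ : Fin (size 𝔅) → Fin (size 𝔅)} where

  apply-cong : (α : App 𝔅 E nV) {g g' : Fin nV → Fin (dom E)} → g ≗ g' →
               apply 𝔅 E α g ≡ apply 𝔅 E α g'
  apply-cong (i , vs) g≗g' = cong (fun E i) (map-cong g≗g' vs)

  apply-σ̃ : {α β : App 𝔅 E nV} → IsSigmaImage 𝔅 E ρ τ α β →
            (g : Fin nV → Fin (dom E)) → apply 𝔅 E β g ≡ τ (apply 𝔅 E α (ρ ∘ g))
  apply-σ̃ {i , vs} {j , .(subst (Vec (Fin nV)) p vs)} (p , σ̃fᵢ≡fⱼ , refl) g = begin
    fun E j (map g (subst (Vec (Fin nV)) p vs))  ≡⟨ cong (fun E j) (sym (subst-application′ (Vec (Fin nV)) (λ _ → map g) p)) ⟩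
    fun E j (subst (Vec (Fin (dom E))) p (map g vs)) ≡⟨ sym (σ̃fᵢ≡fⱼ (map g vs)) ⟩
    τ (fun E i (map ρ (map g vs)))                 ≡⟨ cong (τ ∘ fun E i) (map-∘ ρ g vs) ⟨
    τ (fun E i (map (ρ ∘ g) vs))                   ∎
    where open ≡-Reasoning

  module _ (σ : IsInnerSymmetry 𝔅 E ρ τ) where
    open IsInnerSymmetry σ

    σ̃-image : (α : App 𝔅 E nV) → ∃ λ β → IsSigmaImage 𝔅 E ρ τ α β
    σ̃-image (i , vs) with image⊆F i
    ... | j , p , σ̃fᵢ≡fⱼ = (j , subst (Vec (Fin nV)) p vs) , p , σ̃fᵢ≡fⱼ , refl

    σ̃-preimage : (β : App 𝔅 E nV) → ∃ λ α → IsSigmaImage 𝔅 E ρ τ α β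
    σ̃-preimage (j , ws) with F⊆image j
    ... | i , p , σ̃fᵢ≡fⱼ = (i , subst (Vec (Fin nV)) (sym p) ws) , p , σ̃fᵢ≡fⱼ , subst-subst-sym p

    T-∘-σ̃ : (s : App 𝔅 E nV → App 𝔅 E nV) → (∀ α → IsSigmaImage 𝔅 E ρ τ α (s α)) →
            ∀ t → T 𝔅 E nV t → InClosure 𝔅 (T 𝔅 E nV) (t ∘ s)
    T-∘-σ̃ s s-σ̃ t (g , t≗g) =
      InClosure-cong 𝔅 (λ α → sym (trans (t≗g (s α)) (apply-σ̃ (s-σ̃ α) g)))
        (InClosure-automorphism⁺ 𝔅 τ-auto (ρ ∘ g , λ _ → refl))

    T-∘-σ̃⁻¹ : (r : App 𝔅 E nV → App 𝔅 E nV) → (∀ β → IsSigmaImage 𝔅 E ρ τ (r β) β) →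
              ∀ t → T 𝔅 E nV t → InClosure 𝔅 (T 𝔅 E nV) (t ∘ r)
    T-∘-σ̃⁻¹ r r-σ̃ t (g , t≗g) =
      InClosure-automorphism⁻ 𝔅 τ-auto (ρ⁻¹ ∘ g , λ β → begin
        τ (t (r β))                            ≡⟨ cong τ (t≗g (r β)) ⟩
        τ (apply 𝔅 E (r β) g)                  ≡⟨ cong τ (apply-cong (r β) (ρρ⁻¹ ∘ g)) ⟨
        τ (apply 𝔅 E (r β) (ρ ∘ ρ⁻¹ ∘ g))      ≡⟨ apply-σ̃ (r-σ̃ β) (ρ⁻¹ ∘ g) ⟨
        apply 𝔅 E β (ρ⁻¹ ∘ g)                  ∎)
      where
      open ≡-Reasoning
      ρ⁻¹ : Fin (dom E) → Fin (dom E)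
      ρ⁻¹ y = proj₁ (proj₂ ρ-bijective y)
      ρρ⁻¹ : ∀ y → ρ (ρ⁻¹ y) ≡ y
      ρρ⁻¹ y = proj₂ (proj₂ ρ-bijective y) refl

theorem2p8 : (𝔅 : Structure) (E : Encoding 𝔅)
             (ρ : Fin (dom E) → Fin (dom E)) (τ : Fin (size 𝔅) → Fin (size 𝔅)) →
             IsInnerSymmetry 𝔅 E ρ τ →
             (nV : ℕ) → 1 ≤ nV →
             (u u' : App 𝔅 E nV → Fin (size 𝔅)) →
             (∀ α β → IsSigmaImage 𝔅 E ρ τ α β → u' α ≡ u β) →
             (InClosure 𝔅 (T 𝔅 E nV) u ⇔ InClosure 𝔅 (T 𝔅 E nV) u')
theorem2p8 𝔅 E ρ τ σ nV _ u u' u'≡u∘σ̃ = mk⇔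
  (λ u∈⟨T⟩ → InClosure-cong 𝔅 (λ α → sym (u'≡u∘σ̃ α _ (s-σ̃ α)))
               (InClosure-∘ 𝔅 s (T-∘-σ̃ σ s s-σ̃) u∈⟨T⟩))
  (λ u'∈⟨T⟩ → InClosure-cong 𝔅 (λ β → u'≡u∘σ̃ _ β (r-σ̃ β))
                (InClosure-∘ 𝔅 r (T-∘-σ̃⁻¹ σ r r-σ̃) u'∈⟨T⟩))
  where
  s r : App 𝔅 E nV → App 𝔅 E nV
  s = proj₁ ∘ σ̃-image σ
  r = proj₁ ∘ σ̃-preimage σ
  s-σ̃ : ∀ α → IsSigmaImage 𝔅 E ρ τ α (s α)
  s-σ̃ = proj₂ ∘ σ̃-image σ
  r-σ̃ : ∀ β → IsSigmaImage 𝔅 E ρ τ (r β) β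
  r-σ̃ = proj₂ ∘ σ̃-preimage σ
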